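{- If $G$ is a finite connected graph, then $\mathrm{rc}(G) \geq \left\lfloor \frac{g(G)}{2}\right\rfloor-1$.
   Context: Cop and robber game with radius of capture $k$ on a graph $G$: first the cop chooses a vertex, then the robber chooses a vertex; afterwards, starting with the cop, the players alternately either move to an adjacent vertex or stay put, both knowing both positions. The cop wins if at some point the distance between the players is at most $k$. $\mathcal{CWRC}(k)$ is the class of graphs on which the cop has a winning strategy. $\mathrm{rc}(G)=\min\{k\in\mathbb{N}_0 \mid G\in\mathcal{CWRC}(k)\}$. The girth $g(G)$ is the length of a shortest cycle of $G$; acyclic graphs are considered to have girth $0$. -}

module Defs where

open import Data.Nat using (ℕ; zero; suc; _≤_; _<_)
open import Data.Fin using (Fin; zero; suc; inject₁; fromℕ)
open import Data.Product using (Σ; ∃; _×_; _,_; proj₁; proj₂)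
open import Data.Sum using (_⊎_)
open import Data.List using (List; []; _∷_)
open import Relation.Binary.PropositionalEquality using (_≡_)
open import Relation.Binary.Definitions using (Decidable)
open import Relation.Nullary using (¬_)
open import Function.Definitions using (Injective)

record Graph : Set₁ where
  field
    n         : ℕ
    Adj       : Fin n → Fin n → Set
    adj-sym   : ∀ {u v} → Adj u v → Adj v u
    adj-irr   : ∀ {u} → ¬ Adj u u
    adj-dec   : Decidable Adj

module _ (G : Graph) where
  open Graph G

  V : Set
  V = Fin n

  data Walk : V → V → ℕ → Set where
    here : ∀ {u} → Walk u u 0
    step : ∀ {u w v k} → Adj u w → Walk w v k → Walk u v (suc k)

  DistLE : ℕ → V → V → Set
  DistLE k u v = Σ ℕ λ m → m ≤ k × Walk u v m

  Connected : Set
  Connected = V × (∀ u v → Σ ℕ λ m → Walk u v m)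

  HasCycle : ℕ → Set
  HasCycle ℓ = Σ ℕ λ m → (ℓ ≡ suc m) × (2 ≤ m) ×
    Σ (Fin (suc m) → V) λ f → Injective _≡_ _≡_ f ×
      (∀ (i : Fin m) → Adj (f (inject₁ i)) (f (suc i))) ×
      Adj (f (fromℕ m)) (f zero)

  IsGirth : ℕ → Set
  IsGirth g = ((g ≡ 0) × (∀ ℓ → ¬ HasCycle ℓ))
            ⊎ (HasCycle g × (∀ ℓ → HasCycle ℓ → g ≤ ℓ))

  Move : V → V → Set
  Move u v = (u ≡ v) ⊎ Adj u v

  -- Histories: list of previous round positions (cop , robber), newest first.
  record CopStrategy : Set where
    field
      start : V
      move  : List (V × V) → V → V → V   -- history, cop pos, robber pos
      legal : ∀ h c r → Move c (move h c r)

  record RobberStrategy : Set where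
    field
      start : V → V                       -- depends on the cop's start
      move  : List (V × V) → V → V → V   -- history, new cop pos, robber pos
      legal : ∀ h c r → Move r (move h c r)

  play : CopStrategy → RobberStrategy → ℕ → (V × V) × List (V × V)
  play σ ρ zero = (CopStrategy.start σ , RobberStrategy.start ρ (CopStrategy.start σ)) , []
  play σ ρ (suc t) with play σ ρ t
  ... | (c , r) , h =
    let c′ = CopStrategy.move σ h c r
        r′ = RobberStrategy.move ρ ((c , r) ∷ h) c′ r
    in (c′ , r′) , ((c , r) ∷ h)

  pos : CopStrategy → RobberStrategy → ℕ → V × V
  pos σ ρ t = proj₁ (play σ ρ t)

  -- the cop wins the play if at some moment (after the robber's placement/move,
  -- or after the cop's move) the distance is at most k
  CopWinsPlay : ℕ → CopStrategy → RobberStrategy → Set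
  CopWinsPlay k σ ρ = ∃ λ t →
      DistLE k (proj₁ (pos σ ρ t)) (proj₂ (pos σ ρ t))
    ⊎ DistLE k (proj₁ (pos σ ρ (suc t))) (proj₂ (pos σ ρ t))

  CWRC : ℕ → Set
  CWRC k = Σ CopStrategy λ σ → ∀ (ρ : RobberStrategy) → CopWinsPlay k σ ρ

  -- rc(G) ≥ b, where rc(G) = min {k | G ∈ CWRC(k)}
  RcGE : ℕ → Set
  RcGE b = ∀ k → CWRC k → b ≤ k

{-# OPTIONS --safe #-}
-- Suppose the girth g is at least 2k + 4.  If y is at distance d ≤ k + 1 from x, then at
-- most one neighbour of y is at distance ≤ d from x: two of them, together with geodesics
-- from x, would close a cycle of length ≤ 2d + 1 < g.  So a robber on a shortest cycle C
-- who is at distance ≥ k + 1 from the cop after the cop's move can step along C to distance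
-- ≥ k + 2, and an initial position at distance ≥ k + 2 is reached by climbing along C
-- away from the cop.
module Submission where

open import Defs
open import Data.Nat using (ℕ; zero; suc; _+_; _*_; _∸_; _/_; _≤_; _<_; z≤n; s≤s; z<s; _≤?_)
open import Data.Nat.DivMod using (m/n*n≤m)
open import Data.Nat.Properties
open import Data.Fin as Fin using (Fin; zero; suc; toℕ; inject₁; fromℕ)
open import Data.Fin.Properties using (any?; toℕ-injective; toℕ-inject₁; toℕ-fromℕ; toℕ<n; toℕ≤pred[n])
open import Data.Product as Product using (Σ; ∃; _×_; _,_; proj₁; proj₂)
open import Data.Sum as Sum using (_⊎_; inj₁; inj₂)
open import Data.Empty using (⊥-elim)
open import Relation.Nullary using (¬_; Dec; yes; no)
open import Relation.Nullary.Decidable using (_×-dec_)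
open import Relation.Binary.PropositionalEquality
open import Function.Base using (_∘_)
open import Function.Definitions using (Injective)
open import Data.Nat.Tactic.RingSolver using (solve-∀)

data InitLast {M : ℕ} : Fin (suc M) → Set where
  last : InitLast (fromℕ M)
  init : (j : Fin M) → InitLast (inject₁ j)

initLast : ∀ {M} (i : Fin (suc M)) → InitLast i
initLast {zero}  zero    = last
initLast {suc M} zero    = init zero
initLast {suc M} (suc i) with initLast i
... | last   = last
... | init j = init (suc j)

prev : ∀ {M} → Fin (suc M) → Fin (suc M)
prev {M} zero    = fromℕ M
prev     (suc j) = inject₁ j

next : ∀ {M} → Fin (suc M) → Fin (suc M)
next i with initLast i
... | last   = zero
... | init j = suc j

prev≢next : ∀ {M} → 2 ≤ M → (i : Fin (suc M)) → prev i ≢ next i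
prev≢next (s≤s (s≤s _)) i with initLast i
... | last         = λ ()
... | init zero    = λ ()
... | init (suc j) = λ eq → <⇒≢ (m<n+m (toℕ j) z<s)
                                (trans (sym (trans (toℕ-inject₁ (inject₁ j)) (toℕ-inject₁ j))) (cong toℕ eq))

module _ (G : Graph) where
  open Graph G

  private variable
    x y z u v w c c′ r : V G
    a b d e j m : ℕ
    h : ℕ → V G

  _∷ʳ_ : Walk G u v j → Adj v w → Walk G u w (suc j)
  here      ∷ʳ vw = step vw here
  step uv p ∷ʳ vw = step uv (p ∷ʳ vw)

  unsnoc : Walk G u w (suc j) → Σ (V G) λ v → Walk G u v j × Adj v w
  unsnoc (step uw here) = _ , here , uw
  unsnoc (step uv (step vv′ p)) with unsnoc (step vv′ p)
  ... | v , q , vw = v , step uv q , vw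

  walk₀⇒≡ : Walk G u v 0 → u ≡ v
  walk₀⇒≡ here = refl

  Adj⇒≢ : Adj u v → u ≢ v
  Adj⇒≢ uv refl = adj-irr uv

  DistGE : ℕ → V G → V G → Set
  DistGE d x y = ∀ {j} → Walk G x y j → d ≤ j

  DistEq : ℕ → V G → V G → Set
  DistEq d x y = Walk G x y d × DistGE d x y

  DistGE-weaken : e ≤ d → DistGE d x y → DistGE e x y
  DistGE-weaken e≤d ge p = ≤-trans e≤d (ge p)

  DistGE-pred : DistGE (suc d) x y → Adj z y → DistGE d x z
  DistGE-pred ge zy p = ≤-pred (ge (p ∷ʳ zy))

  DistEq-unique : DistEq d x y → DistEq e x y → d ≡ e
  DistEq-unique (p , ge) (q , ge′) = ≤-antisym (ge q) (ge′ p)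

  ¬DistLE⇒DistGE : ¬ DistLE G d x y → DistGE (suc d) x y
  ¬DistLE⇒DistGE ¬le p = ≰⇒> λ j≤d → ¬le (_ , j≤d , p)

  DistGE⇒¬DistLE : DistGE (suc d) x y → ¬ DistLE G d x y
  DistGE⇒¬DistLE ge (_ , j≤d , p) = <⇒≱ (ge p) j≤d

  DistLE? : ∀ d x y → Dec (DistLE G d x y)
  DistLE? d x y with x Fin.≟ y
  ... | yes refl = yes (0 , z≤n , here)
  DistLE? zero x y | no x≢y = no λ { (zero , _ , p) → x≢y (walk₀⇒≡ p) }
  DistLE? (suc d) x y | no x≢y with any? (λ w → adj-dec x w ×-dec DistLE? d w y)
  ... | yes (w , xw , j , j≤d , p) = yes (suc j , s≤s j≤d , step xw p)
  ... | no ¬via = no λ { (zero , _ , p) → x≢y (walk₀⇒≡ p)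
                       ; (suc j , s≤s j≤d , step xw p) → ¬via (_ , xw , j , j≤d , p) }

  DistLE⇒DistEq : DistLE G d x y → Σ ℕ λ e → e ≤ d × DistEq e x y
  DistLE⇒DistEq {zero} (zero , z≤n , p) = 0 , z≤n , p , λ _ → z≤n
  DistLE⇒DistEq {suc d} {x} {y} (j , j≤ , p) with DistLE? d x y
  ... | yes le = let e , e≤d , E = DistLE⇒DistEq le in e , m≤n⇒m≤1+n e≤d , E
  ... | no ¬le = j , j≤ , p , DistGE-weaken j≤ (¬DistLE⇒DistGE ¬le)

  DistLE⇒DistEq-suc : DistLE G (suc d) x y → ¬ DistLE G d x y → DistEq (suc d) x y
  DistLE⇒DistEq-suc le ¬le with DistLE⇒DistEq le
  ... | e , e≤ , E@(p , _) with m≤n⇒m<n∨m≡n e≤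
  ...   | inj₁ e<  = ⊥-elim (¬le (e , ≤-pred e< , p))
  ...   | inj₂ refl = E

  DistLE-move : Move G c c′ → DistLE G d c′ r → DistLE G (suc d) c r
  DistLE-move (inj₁ refl) (j , j≤d , p) = j , m≤n⇒m≤1+n j≤d , p
  DistLE-move (inj₂ cc′)  (j , j≤d , p) = suc j , s≤s j≤d , step cc′ p

  record IsPath (h : ℕ → V G) (m : ℕ) : Set where
    field
      injective : ∀ {s t} → s ≤ m → t ≤ m → h s ≡ h t → s ≡ t
      adjacent  : ∀ {t} → t < m → Adj (h t) (h (suc t))

  cons : V G → (ℕ → V G) → ℕ → V G
  cons v h zero    = v
  cons v h (suc t) = h t

  reverse : ℕ → (ℕ → V G) → ℕ → V G
  reverse m h t = h (m ∸ t)

  IsPath-point : IsPath (λ _ → v) 0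
  IsPath-point = record { injective = λ { z≤n z≤n _ → refl } ; adjacent = λ () }

  IsPath-cons : IsPath h m → Adj v (h 0) → (∀ {t} → t ≤ m → v ≢ h t) → IsPath (cons v h) (suc m)
  IsPath-cons {h} {m} {v} P vh₀ fresh = record { injective = inj ; adjacent = adj }
    where
    open IsPath P
    inj : ∀ {s t} → s ≤ suc m → t ≤ suc m → cons v h s ≡ cons v h t → s ≡ t
    inj {zero}  {zero}  _         _         _  = refl
    inj {zero}  {suc t} _         (s≤s t≤m) eq = ⊥-elim (fresh t≤m eq)
    inj {suc s} {zero}  (s≤s s≤m) _         eq = ⊥-elim (fresh s≤m (sym eq))
    inj {suc s} {suc t} (s≤s s≤m) (s≤s t≤m) eq = cong suc (injective s≤m t≤m eq)
    adj : ∀ {t} → t < suc m → Adj (cons v h t) (cons v h (suc t))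
    adj {zero}  _         = vh₀
    adj {suc t} (s≤s t<m) = adjacent t<m

  IsPath-edge : Adj u v → IsPath (cons u (λ _ → v)) 1
  IsPath-edge uv = IsPath-cons IsPath-point uv λ { z≤n → Adj⇒≢ uv }

  IsPath-reverse : IsPath h m → IsPath (reverse m h) m
  IsPath-reverse {h} {m} P = record { injective = inj ; adjacent = adj }
    where
    open IsPath P
    inj : ∀ {s t} → s ≤ m → t ≤ m → h (m ∸ s) ≡ h (m ∸ t) → s ≡ t
    inj {s} {t} s≤m t≤m eq = ∸-cancelˡ-≡ s≤m t≤m (injective (m∸n≤m m s) (m∸n≤m m t) eq)
    adj : ∀ {t} → t < m → Adj (h (m ∸ t)) (h (m ∸ suc t))
    adj {t} t<m = subst (λ s → Adj (h s) (h (m ∸ suc t))) (sym (+-∸-assoc 1 t<m))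
                        (adj-sym (adjacent (∸-monoʳ-< z<s t<m)))

  IsPath⇒HasCycle : IsPath h m → 2 ≤ m → Adj (h m) (h 0) → HasCycle G (suc m)
  IsPath⇒HasCycle {h} {m} P 2≤m hₘh₀ = m , refl , 2≤m , (h ∘ toℕ) , inj , adj , close
    where
    open IsPath P
    inj : Injective _≡_ _≡_ (h ∘ toℕ)
    inj {i} {j} eq = toℕ-injective (injective (toℕ≤pred[n] i) (toℕ≤pred[n] j) eq)
    adj : ∀ i → Adj (h (toℕ (inject₁ i))) (h (toℕ (suc i)))
    adj i = subst (λ s → Adj (h s) (h (suc (toℕ i)))) (sym (toℕ-inject₁ i)) (adjacent (toℕ<n i))
    close : Adj (h (toℕ (fromℕ m))) (h 0)
    close = subst (λ s → Adj (h s) (h 0)) (sym (toℕ-fromℕ m)) hₘh₀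

  HasCycle≤ : ℕ → Set
  HasCycle≤ B = Σ ℕ λ ℓ → HasCycle G ℓ × ℓ ≤ B

  HasCycle≤-mono : a ≤ b → HasCycle≤ a → HasCycle≤ b
  HasCycle≤-mono a≤b (ℓ , C , ℓ≤a) = ℓ , C , ≤-trans ℓ≤a a≤b

  -- Geodesics from x of lengths a and b whose ends are joined by a path h of length m with
  -- interior at distance ≥ max a b from x.  Stepping back along the longer geodesic and
  -- prepending to h preserves this shape until the geodesics meet, which closes a cycle of
  -- length ≤ a + b + m.
  record Zipper (x : V G) (a b m : ℕ) (h : ℕ → V G) : Set where
    field
      geodesicˡ  : DistEq a x (h 0)
      geodesicʳ  : DistEq b x (h m)
      path       : IsPath h m
      interior   : ∀ {t} → 0 < t → t < m → DistGE a x (h t) × DistGE b x (h t)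
      -- For m ≡ 1 the first vertex prepended lies at distance a ∸ 1 ≠ b, so no 2-cycle arises.
      nontrivial : 2 ≤ m ⊎ (m ≡ 1 × a ≡ b)

    open IsPath path public

    positive : 0 < m
    positive with nontrivial
    ... | inj₁ 2≤m        = ≤-trans (s≤s z≤n) 2≤m
    ... | inj₂ (refl , _) = s≤s z≤n

  Zipper-swap : Zipper x a b m h → Zipper x b a m (reverse m h)
  Zipper-swap {x} {a} {b} {m} {h} Z = record
    { geodesicˡ  = geodesicʳ
    ; geodesicʳ  = subst (λ s → DistEq a x (h s)) (sym (n∸n≡0 m)) geodesicˡ
    ; path       = IsPath-reverse path
    ; interior   = λ 0<t t<m → Product.swap (interior (m<n⇒0<n∸m t<m) (∸-monoʳ-< 0<t (<⇒≤ t<m)))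
    ; nontrivial = Sum.map₂ (Product.map₂ sym) nontrivial
    }
    where open Zipper Z

  Zipper-shrinkˡ : Zipper x (suc a) b m h → b ≤ suc a →
                   HasCycle≤ (suc m) ⊎ Σ (V G) λ v → Zipper x a b (suc m) (cons v h)
  Zipper-shrinkˡ {x} {a} {b} {m} {h} Z b≤1+a with unsnoc (proj₁ (Zipper.geodesicˡ Z))
  ... | v , xv , vh₀ with v Fin.≟ h m
  ... | yes refl = inj₁ (suc m , IsPath⇒HasCycle path 2≤m vh₀ , ≤-refl)
    where
    open Zipper Z
    a≡b : a ≡ b
    a≡b = DistEq-unique (xv , DistGE-pred (proj₂ geodesicˡ) vh₀) geodesicʳ
    2≤m : 2 ≤ m
    2≤m with nontrivial
    ... | inj₁ 2≤m          = 2≤m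
    ... | inj₂ (_ , 1+a≡b) = ⊥-elim (1+n≢n (trans 1+a≡b (sym a≡b)))
  ... | no v≢hₘ = inj₂ (v , record
    { geodesicˡ  = xv , DistGE-pred (proj₂ geodesicˡ) vh₀
    ; geodesicʳ  = geodesicʳ
    ; path       = IsPath-cons path vh₀ fresh
    ; interior   = interior′
    ; nontrivial = inj₁ (s≤s positive)
    })
    where
    open Zipper Z
    fresh : ∀ {t} → t ≤ m → v ≢ h t
    fresh {zero}  _   refl = adj-irr vh₀
    fresh {suc t} t≤m refl with m≤n⇒m<n∨m≡n t≤m
    ... | inj₁ t<m  = 1+n≰n (proj₁ (interior z<s t<m) xv)
    ... | inj₂ refl = v≢hₘ refl
    interior′ : ∀ {t} → 0 < t → t < suc m → DistGE a x (cons v h t) × DistGE b x (cons v h t)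
    interior′ {suc zero}    _ _ = DistGE-weaken (n≤1+n a) (proj₂ geodesicˡ)
                                , DistGE-weaken b≤1+a (proj₂ geodesicˡ)
    interior′ {suc (suc t)} _ (s≤s t<m) = Product.map₁ (DistGE-weaken (n≤1+n a)) (interior z<s t<m)

  zipper⇒HasCycle≤ : Zipper x a b m h → HasCycle≤ (a + b + m)
  zipper-≥⇒HasCycle≤ : Zipper x a b m h → b ≤ a → HasCycle≤ (a + b + m)

  zipper⇒HasCycle≤ {a = a} {b} {m} Z with b ≤? a
  ... | yes b≤a = zipper-≥⇒HasCycle≤ Z b≤a
  ... | no  b≰a = subst HasCycle≤ (cong (_+ m) (+-comm b a))
                        (zipper-≥⇒HasCycle≤ (Zipper-swap Z) (<⇒≤ (≰⇒> b≰a)))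

  zipper-≥⇒HasCycle≤ {a = zero} {m = m} Z z≤n =
    ⊥-elim (<⇒≢ positive (injective z≤n ≤-refl (trans (sym (walk₀⇒≡ (proj₁ geodesicˡ)))
                                                      (walk₀⇒≡ (proj₁ geodesicʳ)))))
    where open Zipper Z
  zipper-≥⇒HasCycle≤ {a = suc a} {b} {m} Z b≤1+a with Zipper-shrinkˡ Z b≤1+a
  ... | inj₁ C        = HasCycle≤-mono (s≤s (m≤n+m m (a + b))) C
  ... | inj₂ (_ , Z′) = subst HasCycle≤ (+-suc (a + b) m) (zipper⇒HasCycle≤ Z′)

  edge-zipper : DistEq d x u → DistEq d x v → Adj u v → Zipper x d d 1 (cons u (λ _ → v))
  edge-zipper Eᵤ Eᵥ uv = record
    { geodesicˡ  = Eᵤ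
    ; geodesicʳ  = Eᵥ
    ; path       = IsPath-edge uv
    ; interior   = λ { {suc _} _ (s≤s ()) }
    ; nontrivial = inj₂ (refl , refl)
    }

  DistEq-neighbour : DistEq d x y → Adj v y → DistEq e x v → e < d → d ≡ suc e
  DistEq-neighbour (_ , ge) vy (pᵥ , _) e<d = ≤-antisym (ge (pᵥ ∷ʳ vy)) e<d

  close-neighbours⇒HasCycle≤ : DistEq d x y → Adj u y → Adj y w → u ≢ w →
                               DistLE G d x u → DistLE G d x w → HasCycle≤ (suc (d + d))
  close-neighbours⇒HasCycle≤ {d} {x} {y} {u} {w} E uy yw u≢w Dᵤ Dʷ
    with DistLE⇒DistEq Dᵤ | DistLE⇒DistEq Dʷ
  ... | eᵤ , eᵤ≤d , Eᵤ | eʷ , eʷ≤d , Eʷ with m≤n⇒m<n∨m≡n eᵤ≤d | m≤n⇒m<n∨m≡n eʷ≤d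
  ... | inj₂ refl | _ = subst HasCycle≤ (+-comm (d + d) 1) (zipper⇒HasCycle≤ (edge-zipper Eᵤ E uy))
  ... | _ | inj₂ refl = subst HasCycle≤ (+-comm (d + d) 1) (zipper⇒HasCycle≤ (edge-zipper E Eʷ yw))
  ... | inj₁ eᵤ<d | inj₁ eʷ<d
    with DistEq-neighbour E uy Eᵤ eᵤ<d | DistEq-neighbour E (adj-sym yw) Eʷ eʷ<d
  ... | refl | refl = HasCycle≤-mono (m≤n⇒m≤1+n (≤-reflexive (two-steps eᵤ))) (zipper⇒HasCycle≤ Z)
    where
    two-steps : ∀ e → e + e + 2 ≡ suc e + suc e
    two-steps = solve-∀
    fresh : ∀ {t} → t ≤ 1 → u ≢ cons y (λ _ → w) t
    fresh z≤n       = Adj⇒≢ uy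
    fresh (s≤s z≤n) = u≢w
    Z : Zipper x eᵤ eᵤ 2 (cons u (cons y (λ _ → w)))
    Z = record
      { geodesicˡ  = Eᵤ
      ; geodesicʳ  = Eʷ
      ; path       = IsPath-cons (IsPath-edge yw) uy fresh
      ; interior   = λ { {suc zero} _ _ → DistGE-weaken (n≤1+n eᵤ) (proj₂ E)
                                        , DistGE-weaken (n≤1+n eᵤ) (proj₂ E)
                       ; {suc (suc _)} _ (s≤s (s≤s ())) }
      ; nontrivial = inj₁ ≤-refl
      }

  module Robber (k : ℕ) {M : ℕ} (2≤M : 2 ≤ M) (f : Fin (suc M) → V G)
                (f-injective : Injective _≡_ _≡_ f)
                (f-adj : ∀ i → Adj (f (inject₁ i)) (f (suc i)))
                (f-close : Adj (f (fromℕ M)) (f zero))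
                (no-short-cycle : ¬ HasCycle≤ (suc (suc k + suc k))) where

    adj-prev : ∀ i → Adj (f (prev i)) (f i)
    adj-prev zero    = f-close
    adj-prev (suc j) = f-adj j

    adj-next : ∀ i → Adj (f i) (f (next i))
    adj-next i with initLast i
    ... | last   = f-close
    ... | init j = f-adj j

    farther-neighbour : ∀ {x d} i → d ≤ suc k → DistEq d x (f i) →
                        Σ (Fin (suc M)) λ j → Adj (f i) (f j) × ¬ DistLE G d x (f j)
    farther-neighbour {x} {d} i d≤1+k E with DistLE? d x (f (next i))
    ... | no far = next i , adj-next i , far
    ... | yes Dₙ with DistLE? d x (f (prev i))
    ...   | no far = prev i , adj-sym (adj-prev i) , far
    ...   | yes Dₚ = ⊥-elim (no-short-cycle (HasCycle≤-mono (s≤s (+-mono-≤ d≤1+k d≤1+k))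
                      (close-neighbours⇒HasCycle≤ E (adj-prev i) (adj-next i)
                                                  (prev≢next 2≤M i ∘ f-injective) Dₚ Dₙ)))

    OnCycle : V G → Set
    OnCycle r = ∃ λ i → f i ≡ r

    Safe : V G → V G → Set
    Safe c r = OnCycle r × ¬ DistLE G (suc k) c r

    flee : ∀ {c′} i → ¬ DistLE G k c′ (f i) →
           Σ (Fin (suc M)) λ j → Move G (f i) (f j) × ¬ DistLE G (suc k) c′ (f j)
    flee {c′} i ¬near with DistLE? (suc k) c′ (f i)
    ... | no far   = i , inj₁ refl , far
    ... | yes near = Product.map₂ (Product.map₁ inj₂)
                                  (farther-neighbour i ≤-refl (DistLE⇒DistEq-suc near ¬near))

    respond : ∀ c′ r → Σ (V G) λ r′ → Move G r r′ × (OnCycle r → ¬ DistLE G k c′ r → Safe c′ r′)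
    respond c′ r with any? (λ i → f i Fin.≟ r) | DistLE? k c′ r
    ... | yes (i , refl) | no ¬near = let j , move , far = flee i ¬near
                                      in f j , move , λ _ _ → (j , refl) , far
    ... | no off | _        = r , inj₁ refl , λ on _ → ⊥-elim (off on)
    ... | _      | yes near = r , inj₁ refl , λ _ ¬near → ⊥-elim (¬near near)

    climb : ∀ n {c d} i → n + d ≡ suc (suc k) → DistEq d c (f i) → Σ (V G) (Safe c)
    climb zero    i refl (_ , ge) = f i , (i , refl) , DistGE⇒¬DistLE ge
    climb (suc n) {d = d} i n+d≡ E
      with farther-neighbour i (subst (d ≤_) (suc-injective n+d≡) (m≤n+m d n)) E
    ... | j , fᵢfⱼ , far = climb n j (trans (+-suc n d) n+d≡) (proj₁ E ∷ʳ fᵢfⱼ , ¬DistLE⇒DistGE far)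

    place : ∀ c → Σ (V G) (Safe c)
    place c with DistLE? (suc k) c (f zero)
    ... | no far   = f zero , (zero , refl) , far
    ... | yes near with DistLE⇒DistEq near
    ...   | e , e≤ , E = climb (suc (suc k) ∸ e) zero (m∸n+n≡m (m≤n⇒m≤1+n e≤)) E

    robber : RobberStrategy G
    robber = record
      { start = λ c → proj₁ (place c)
      ; move  = λ _ c′ r → proj₁ (respond c′ r)
      ; legal = λ _ c′ r → proj₁ (proj₂ (respond c′ r))
      }

    module _ (σ : CopStrategy G) where
      open CopStrategy σ using (start; move; legal)

      safe : ∀ t → Safe (proj₁ (pos G σ robber t)) (proj₂ (pos G σ robber t))
      safe zero = proj₂ (place start)
      safe (suc t) with play G σ robber t | safe t
      ... | (c , r) , h | on , far =
        proj₂ (proj₂ (respond (move h c r) r)) on (far ∘ DistLE-move (legal h c r))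

      cop-misses : ∀ t → ¬ DistLE G k (proj₁ (pos G σ robber (suc t))) (proj₂ (pos G σ robber t))
      cop-misses t with play G σ robber t | safe t
      ... | (c , r) , h | _ , far = far ∘ DistLE-move (legal h c r)

      robber-evades : ¬ CopWinsPlay G k σ robber
      robber-evades (t , inj₁ (j , j≤k , p)) = proj₂ (safe t) (j , m≤n⇒m≤1+n j≤k , p)
      robber-evades (t , inj₂ caught)        = cop-misses t caught

    ¬CWRC : ¬ CWRC G k
    ¬CWRC (σ , wins) = robber-evades σ (wins robber)

  large-girth⇒¬CWRC : ∀ {ℓ k} → HasCycle G ℓ → ¬ HasCycle≤ (suc (suc k + suc k)) → ¬ CWRC G k
  large-girth⇒¬CWRC {k = k} (_ , _ , 2≤M , f , f-injective , f-adj , f-close) =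
    Robber.¬CWRC k 2≤M f f-injective f-adj f-close

half-girth-exceeds : ∀ g k → ¬ (g / 2 ∸ 1 ≤ k) → suc (suc k + suc k) < g
half-girth-exceeds g k ¬bound = begin-strict
  suc (suc k + suc k)       <⟨ n<1+n _ ⟩
  suc (suc (suc k + suc k)) ≡⟨ cong suc (+-suc (suc k) (suc k)) ⟨
  suc (suc k) + suc (suc k) ≤⟨ +-mono-≤ 2+k≤q 2+k≤q ⟩
  q + q                     ≡⟨ double q ⟩
  q * 2                     ≤⟨ m/n*n≤m g 2 ⟩
  g                         ∎
  where
  open ≤-Reasoning
  q : ℕ
  q = g / 2
  double : ∀ n → n + n ≡ n * 2
  double = solve-∀
  2+k≤ : ∀ n → suc k ≤ n ∸ 1 → suc (suc k) ≤ n
  2+k≤ zero    ()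
  2+k≤ (suc n) 1+k≤n = s≤s 1+k≤n
  2+k≤q : suc (suc k) ≤ q
  2+k≤q = 2+k≤ q (≰⇒> ¬bound)

theorem3p4 : (G : Graph) → Connected G → (g : ℕ) → IsGirth G g →
    RcGE G ((g / 2) ∸ 1)
theorem3p4 G _ g (inj₁ (refl , _)) k _ = z≤n
theorem3p4 G _ g (inj₂ (C , minimal)) k copWins with g / 2 ∸ 1 ≤? k
... | yes bound = bound
... | no ¬bound = ⊥-elim (large-girth⇒¬CWRC G C no-short-cycle copWins)
  where
  no-short-cycle : ¬ HasCycle≤ G (suc (suc k + suc k))
  no-short-cycle (ℓ , C′ , ℓ≤) = <⇒≱ (half-girth-exceeds g k ¬bound) (≤-trans (minimal ℓ C′) ℓ≤)
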